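{- Let $d\ge 1$ be an integer and $n\ge 1$ an integer. The number of $d$-restricted directed column-convex polyominoes of area $n$ equals $$\sum_{k=0}^{\lfloor\frac{n+d-2}{d}\rfloor}\binom{n-(d-1)(k-1)}{2k}.$$
   Context: A polyomino $P$ (a finite edge-connected set of unit cells of the square lattice) is directed if every cell $c\in P$ can be joined to the bottom-left corner cell of $P$ by a path of cells contained in $P$ using only north and east steps; it is column-convex if each of its columns is a contiguous vertical segment of cells. A directed column-convex polyomino is abbreviated dccp. The area of a polyomino is its number of cells. For a dccp with columns $1,\dots,k$ from left to right, let $a_i$ be the initial altitude (height of the bottom edge) of column $i$, measured from the bottom of the first column, so the initial-altitude vector is $A=(0,a_2,\dots,a_k)$. For an integer $d\ge 0$, a dccp is $d$-restricted if either it has exactly one or two columns, or its initial-altitude vector satisfies $a_{i+1}-a_i\ge d$ for all $2\le i\le k-1$ (the difference $a_2-a_1$ is not restricted). -}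

module Defs where

open import Data.Nat using (ℕ; zero; suc; _+_; _*_; _∸_; _≤_; _/_; NonZero)
open import Data.Nat.Combinatorics using (_C_)
open import Data.Bool using (Bool; true; false)
open import Data.Vec using (Vec; []; _∷_)
open import Data.List using (List; map; upTo)
open import Data.Nat.ListAction using (sum)
open import Data.Product using (_×_)
open import Relation.Binary.PropositionalEquality using (_≡_)

-- A finite set of cells contained in the box {0..n-1} × {0..n-1}.
-- The grid is stored column-wise: the x-th row vector is column x,
-- its y-th entry says whether cell (x , y) belongs to the set.
Grid : ℕ → Set
Grid n = Vec (Vec Bool n) n

getB : ∀ {m} → Vec Bool m → ℕ → Bool
getB []       _       = false
getB (b ∷ bs) zero    = b
getB (b ∷ bs) (suc y) = getB bs y

cellAt : ∀ {m k} → Vec (Vec Bool k) m → ℕ → ℕ → Bool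
cellAt []       _       _ = false
cellAt (c ∷ cs) zero    y = getB c y
cellAt (c ∷ cs) (suc x) y = cellAt cs x y

In : ∀ {n} → Grid n → ℕ → ℕ → Set
In g x y = cellAt g x y ≡ true

countTrue : ∀ {m} → Vec Bool m → ℕ
countTrue []           = 0
countTrue (true  ∷ bs) = suc (countTrue bs)
countTrue (false ∷ bs) = countTrue bs

area : ∀ {m k} → Vec (Vec Bool k) m → ℕ
area []       = 0
area (c ∷ cs) = countTrue c + area cs

data Reach {n} (g : Grid n) : ℕ → ℕ → Set where
  base  : In g 0 0 → Reach g 0 0
  north : ∀ {x y} → Reach g x y → In g x (suc y) → Reach g x (suc y)
  east  : ∀ {x y} → Reach g x y → In g (suc x) y → Reach g (suc x) y

-- directed polyomino normalised so that its bottom-left corner cell is (0,0)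
-- (every cell is joined to (0,0) by a north/east path inside the set;
-- this also gives edge-connectedness)
IsDirected : ∀ {n} → Grid n → Set
IsDirected g = In g 0 0 × (∀ x y → In g x y → Reach g x y)

IsColumnConvex : ∀ {n} → Grid n → Set
IsColumnConvex g = ∀ x y₁ y y₂ → y₁ ≤ y → y ≤ y₂ → In g x y₁ → In g x y₂ → In g x y

IsBottom : ∀ {n} → Grid n → ℕ → ℕ → Set
IsBottom g x a = In g x a × (∀ y → In g x y → a ≤ y)

-- d-restricted: for columns i = x+1 and i+1 = x+2 with 2 ≤ i ≤ k-1
-- (i.e. x ≥ 1 and column x+1 nonempty), a_{i+1} - a_i ≥ d.
-- Vacuous when there are only one or two columns.
IsRestricted : ∀ {n} → ℕ → Grid n → Set
IsRestricted d g = ∀ x a b → 1 ≤ x → IsBottom g x a → IsBottom g (suc x) b → a + d ≤ b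

IsDRDCCP : (d n : ℕ) → Grid n → Set
IsDRDCCP d n g = IsDirected g × IsColumnConvex g × IsRestricted d g × area g ≡ n

-- sum_{k=0}^{⌊(n+d-2)/d⌋} binom(n-(d-1)(k-1), 2k);
-- n-(d-1)(k-1) is written n+(d-1) ∸ (d-1)k, which is exact in this range.
formula : (d n : ℕ) → .{{_ : NonZero d}} → ℕ
formula d n = sum (map (λ k → (n + (d ∸ 1) ∸ (d ∸ 1) * k) C (2 * k))
                       (upTo (suc ((n + d ∸ 2) / d))))

-- A d-restricted dccp with k + 1 columns is determined by the bottom B and top of each column, where the bottoms
-- of consecutive columns satisfy B₁ + g ≤ B₂ ≤ top₁ with g = 0 for the first step and g = d afterwards. Recording
-- for every step the excess of B₂ over B₁ + g and the distance from B₂ up to top₁, and then the height of the last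
-- column minus one, turns the dccps of area n into the weak compositions of n − m_k into 2k + 1 parts, where
-- m₀ = 1 and m_k = 2k + (d − 1)(k − 1) is the least area with k + 1 columns. There are
-- C(n − m_k + 2k, 2k) = C(n − (d − 1)(k − 1), 2k) of them; only k with m_k ≤ n contribute, these satisfy
-- k ≤ ⌊(n + d − 2)/d⌋, and for the remaining k in that range the binomial coefficient vanishes.

module Submission where

open import Defs
open import Data.Nat using (ℕ; _≤_; NonZero)
open import Data.List using (List; length)
open import Data.List.Membership.Propositional using (_∈_)
open import Data.List.Relation.Unary.All using (All)
open import Data.List.Relation.Unary.Unique.Propositional using (Unique)
open import Data.Product using (Σ; _×_)
open import Relation.Binary.PropositionalEquality using (_≡_)

open import Data.Bool using (Bool; true; false)
open import Data.Bool.Properties using (¬-not)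
open import Data.Empty using (⊥; ⊥-elim; ⊥-elim-irr)
open import Data.List using ([]; _∷_; map; _++_; concatMap; upTo)
open import Data.List.Membership.Propositional using (lose)
open import Data.List.Membership.Propositional.Properties
  using (∈-map⁺; ∈-map⁻; ∈-++⁺ˡ; ∈-++⁺ʳ; ∈-upTo⁺; ∈-concatMap⁺; ∈-concatMap⁻)
open import Data.List.Properties using (length-++; length-map; map-cong; ∷-injectiveʳ)
open import Data.List.Relation.Unary.All using ([]; _∷_)
import Data.List.Relation.Unary.All as All
import Data.List.Relation.Unary.All.Properties as All
open import Data.List.Relation.Unary.Any using (here; there; satisfied)
import Data.List.Relation.Unary.AllPairs as AllPairs
import Data.List.Relation.Unary.AllPairs.Properties as AllPairs
import Data.List.Relation.Unary.Unique.Propositional.Properties as Unique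
open import Data.Nat using (zero; suc; _+_; _*_; _∸_; _<_; s≤s; z≤n)
open import Data.Nat.Properties
open import Data.Nat.Combinatorics using (_C_; nCk+nC[k+1]≡[n+1]C[k+1]; nCn≡1)
open import Data.Nat.Combinatorics.Specification using (k>n⇒nCk≡0)
open import Data.Nat.DivMod using (_/_; m*n/n≡m; /-monoˡ-≤)
open import Data.Nat.ListAction using (sum)
open import Data.Nat.Tactic.RingSolver using (solve-∀)
open import Data.Product using (∃-syntax; _,_; proj₁; proj₂)
open import Data.Vec using (Vec; []; _∷_)
open import Relation.Nullary using (¬_; yes; no)
open import Relation.Binary.PropositionalEquality using (refl; sym; trans; cong; cong₂; subst; module ≡-Reasoning)

data _[_]=_ {A : Set} : List A → ℕ → A → Set where
  at-head : ∀ {x xs} → (x ∷ xs) [ 0 ]= x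
  at-tail : ∀ {x y xs i} → xs [ i ]= y → (x ∷ xs) [ suc i ]= y

[]=-functional : ∀ {A : Set} {xs : List A} {i x y} → xs [ i ]= x → xs [ i ]= y → x ≡ y
[]=-functional at-head     at-head     = refl
[]=-functional (at-tail p) (at-tail q) = []=-functional p q

[]=⇒<length : ∀ {A : Set} {xs : List A} {i x} → xs [ i ]= x → i < length xs
[]=⇒<length at-head     = s≤s z≤n
[]=⇒<length (at-tail p) = s≤s ([]=⇒<length p)

[]=-previous : ∀ {A : Set} {xs : List A} {i y} → xs [ suc i ]= y → ∃[ z ] xs [ i ]= z
[]=-previous {xs = x ∷ _} {i = zero}  (at-tail _) = x , at-head
[]=-previous              {i = suc i} (at-tail p) = let (z , q) = []=-previous p in z , at-tail q

[]=-head : ∀ {A : Set} {xs : List A} {x} → xs [ 0 ]= x → ∃[ xs′ ] xs ≡ x ∷ xs′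
[]=-head (at-head {xs = xs}) = xs , refl

length-concatMap : ∀ {A B : Set} (f : A → List B) xs → length (concatMap f xs) ≡ sum (map (λ x → length (f x)) xs)
length-concatMap f []       = refl
length-concatMap f (x ∷ xs) = trans (length-++ (f x)) (cong (length (f x) +_) (length-concatMap f xs))

map⁺-injectiveOn : ∀ {A B : Set} (f : A → B) {xs} → Unique xs →
  (∀ {x y} → x ∈ xs → y ∈ xs → f x ≡ f y → x ≡ y) → Unique (map f xs)
map⁺-injectiveOn f {[]}     _                    _   = AllPairs.[]
map⁺-injectiveOn f {x ∷ xs} (x∉xs AllPairs.∷ xs!) inj =
  All.map⁺ (All.tabulate λ y∈xs fx≡fy → All.lookup x∉xs y∈xs (inj (here refl) (there y∈xs) fx≡fy))
  AllPairs.∷ map⁺-injectiveOn f xs! (λ x∈ y∈ → inj (there x∈) (there y∈))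

-- Weak compositions

record IsWeakComposition (p M : ℕ) (c : List ℕ) : Set where
  constructor weakComposition
  field
    parts : length c ≡ suc p
    total : sum c ≡ M

incrementHead : List ℕ → List ℕ
incrementHead []       = []
incrementHead (x ∷ xs) = suc x ∷ xs

compositions : ℕ → ℕ → List (List ℕ)
compositions zero    M       = (M ∷ []) ∷ []
compositions (suc p) zero    = map (0 ∷_) (compositions p zero)
compositions (suc p) (suc M) =
  map (0 ∷_) (compositions p (suc M)) ++ map incrementHead (compositions (suc p) M)

length-compositions : ∀ p M → length (compositions p M) ≡ (M + p) C p
length-compositions zero    M    = refl
length-compositions (suc p) zero = begin
  length (map (0 ∷_) (compositions p zero)) ≡⟨ length-map (0 ∷_) (compositions p zero) ⟩
  length (compositions p zero)              ≡⟨ length-compositions p zero ⟩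
  p C p                                     ≡⟨ trans (nCn≡1 p) (sym (nCn≡1 (suc p))) ⟩
  suc p C suc p                             ∎
  where open ≡-Reasoning
length-compositions (suc p) (suc M) = begin
  length (map (0 ∷_) zeroHead ++ map incrementHead positiveHead)
    ≡⟨ length-++ (map (0 ∷_) zeroHead) ⟩
  length (map (0 ∷_) zeroHead) + length (map incrementHead positiveHead)
    ≡⟨ cong₂ _+_ (length-map (0 ∷_) zeroHead) (length-map incrementHead positiveHead) ⟩
  length zeroHead + length positiveHead
    ≡⟨ cong₂ _+_ (length-compositions p (suc M)) (length-compositions (suc p) M) ⟩
  (suc M + p) C p + (M + suc p) C suc p
    ≡⟨ cong (λ m → m C p + (M + suc p) C suc p) (sym (+-suc M p)) ⟩
  (M + suc p) C p + (M + suc p) C suc p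
    ≡⟨ nCk+nC[k+1]≡[n+1]C[k+1] (M + suc p) p ⟩
  suc (M + suc p) C suc p ∎
  where
  open ≡-Reasoning
  zeroHead positiveHead : List (List ℕ)
  zeroHead = compositions p (suc M)
  positiveHead = compositions (suc p) M

compositions-sound : ∀ p M → All (IsWeakComposition p M) (compositions p M)
compositions-sound zero    M       = weakComposition refl (+-identityʳ M) ∷ []
compositions-sound (suc p) zero    = All.gmap⁺ {f = 0 ∷_} cons-zero (compositions-sound p zero)
  where
  cons-zero : ∀ {c} → IsWeakComposition p zero c → IsWeakComposition (suc p) zero (0 ∷ c)
  cons-zero (weakComposition l s) = weakComposition (cong suc l) s
compositions-sound (suc p) (suc M) =
  All.++⁺ (All.gmap⁺ {f = 0 ∷_} cons-zero (compositions-sound p (suc M)))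
          (All.gmap⁺ {f = incrementHead} increment (compositions-sound (suc p) M))
  where
  cons-zero : ∀ {c} → IsWeakComposition p (suc M) c → IsWeakComposition (suc p) (suc M) (0 ∷ c)
  cons-zero (weakComposition l s) = weakComposition (cong suc l) s
  increment : ∀ {c} → IsWeakComposition (suc p) M c → IsWeakComposition (suc p) (suc M) (incrementHead c)
  increment {x ∷ c} (weakComposition l s) = weakComposition l (cong suc s)

compositions-complete : ∀ p M c → IsWeakComposition p M c → c ∈ compositions p M
compositions-complete zero    M       (x ∷ [])    (weakComposition _ s) = here (cong (_∷ []) (trans (sym (+-identityʳ x)) s))
compositions-complete (suc p) zero    (zero ∷ c)  (weakComposition l s) =
  ∈-map⁺ (0 ∷_) (compositions-complete p zero c (weakComposition (suc-injective l) s))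
compositions-complete (suc p) (suc M) (zero ∷ c)  (weakComposition l s) =
  ∈-++⁺ˡ (∈-map⁺ (0 ∷_) (compositions-complete p (suc M) c (weakComposition (suc-injective l) s)))
compositions-complete (suc p) (suc M) (suc x ∷ c) (weakComposition l s) =
  ∈-++⁺ʳ (map (0 ∷_) (compositions p (suc M)))
    (∈-map⁺ incrementHead (compositions-complete (suc p) M (x ∷ c) (weakComposition l (suc-injective s))))

incrementHead-injective : ∀ {xs ys} → incrementHead xs ≡ incrementHead ys → xs ≡ ys
incrementHead-injective {[]}     {[]}     refl = refl
incrementHead-injective {x ∷ xs} {y ∷ ys} refl = refl

zero∷≢incrementHead : ∀ xs ys → 0 ∷ xs ≡ incrementHead ys → ⊥
zero∷≢incrementHead xs []       ()
zero∷≢incrementHead xs (y ∷ ys) ()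

compositions-unique : ∀ p M → Unique (compositions p M)
compositions-unique zero    M       = [] AllPairs.∷ AllPairs.[]
compositions-unique (suc p) zero    = Unique.map⁺ ∷-injectiveʳ (compositions-unique p zero)
compositions-unique (suc p) (suc M) =
  Unique.++⁺ (Unique.map⁺ ∷-injectiveʳ (compositions-unique p (suc M)))
             (Unique.map⁺ incrementHead-injective (compositions-unique (suc p) M))
             disjoint
  where
  disjoint : ∀ {c} → ¬ (c ∈ map (0 ∷_) (compositions p (suc M)) × c ∈ map incrementHead (compositions (suc p) M))
  disjoint (c∈zeroHead , c∈positiveHead) with ∈-map⁻ (0 ∷_) c∈zeroHead | ∈-map⁻ incrementHead c∈positiveHead
  ... | xs , _ , refl | ys , _ , eq = zero∷≢incrementHead xs ys eq

-- Columns and their codes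

-- The column (B , h) occupies the rows B, B + 1, …, B + h.
Column : Set
Column = ℕ × ℕ

columnsArea : List Column → ℕ
columnsArea []             = 0
columnsArea ((B , h) ∷ cs) = suc h + columnsArea cs

-- The columns of d-restricted dccps are those with lo = 0: the paper leaves the first step a₂ − a₁ unrestricted.
data RestrictedColumns (d : ℕ) : ℕ → ℕ → List Column → Set where
  single : ∀ {lo B h} → RestrictedColumns d lo B ((B , h) ∷ [])
  extend : ∀ {lo B h B′ cs} → B + lo ≤ B′ → B′ ≤ B + h → RestrictedColumns d d B′ cs →
           RestrictedColumns d lo B ((B , h) ∷ cs)

RestrictedColumns-head : ∀ {d lo B cs} → RestrictedColumns d lo B cs → ∃[ h ] ∃[ cs′ ] cs ≡ (B , h) ∷ cs′
RestrictedColumns-head (single {h = h})                  = h , [] , refl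
RestrictedColumns-head (extend {h = h} {cs = cs} _ _ _) = h , cs , refl

minArea : ℕ → ℕ → ℕ → ℕ
minArea d lo zero    = 1
minArea d lo (suc k) = suc (lo + minArea d d k)

-- The code j₁ t₁ … j_k t_k h lists, step by step, the excess j of the next bottom over its least value and the
-- distance t from the next bottom up to the current top, and finally the last column's height minus one.
fromCode : ℕ → ℕ → ℕ → List ℕ → List Column
fromCode d lo B []          = []
fromCode d lo B (h ∷ [])    = (B , h) ∷ []
fromCode d lo B (j ∷ t ∷ c) = (B , lo + j + t) ∷ fromCode d d (B + lo + j) c

toCode : ℕ → ℕ → List Column → List ℕ
toCode d lo []                         = []
toCode d lo ((B , h) ∷ [])             = h ∷ []
toCode d lo ((B , h) ∷ (B′ , h′) ∷ cs) = B′ ∸ (B + lo) ∷ B + h ∸ B′ ∷ toCode d d ((B′ , h′) ∷ cs)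

+-reassoc₄ : ∀ a b c d → a + (b + c + d) ≡ a + b + c + d
+-reassoc₄ = solve-∀

length-drop₂ : ∀ (c : List ℕ) k → 2 + length c ≡ suc (2 * suc k) → length c ≡ suc (2 * k)
length-drop₂ c k l = suc-injective (suc-injective (trans l (cong suc (*-suc 2 k))))

fromCode-restricted : ∀ d lo B k c → length c ≡ suc (2 * k) → RestrictedColumns d lo B (fromCode d lo B c)
fromCode-restricted d lo B zero    (h ∷ [])    _ = single
fromCode-restricted d lo B (suc k) (j ∷ t ∷ c) l =
  extend (m≤m+n (B + lo) j) (≤-trans (m≤m+n (B + lo + j) t) (≤-reflexive (sym (+-reassoc₄ B lo j t))))
         (fromCode-restricted d d (B + lo + j) k c (length-drop₂ c k l))

columnsArea-fromCode : ∀ d lo B k c → length c ≡ suc (2 * k) →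
  columnsArea (fromCode d lo B c) ≡ sum c + minArea d lo k
columnsArea-fromCode d lo B zero    (h ∷ [])    _ = single-column h
  where
  single-column : ∀ h → suc h + 0 ≡ h + 0 + 1
  single-column = solve-∀
columnsArea-fromCode d lo B (suc k) (j ∷ t ∷ c) l = begin
  suc (lo + j + t) + columnsArea (fromCode d d (B + lo + j) c)
    ≡⟨ cong (suc (lo + j + t) +_) (columnsArea-fromCode d d (B + lo + j) k c (length-drop₂ c k l)) ⟩
  suc (lo + j + t) + (sum c + minArea d d k)
    ≡⟨ shuffle lo j t (sum c) (minArea d d k) ⟩
  j + (t + sum c) + suc (lo + minArea d d k) ∎
  where
  open ≡-Reasoning
  shuffle : ∀ lo j t s m → suc (lo + j + t) + (s + m) ≡ j + (t + s) + suc (lo + m)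
  shuffle = solve-∀

toCode-fromCode : ∀ d lo B k c → length c ≡ suc (2 * k) → toCode d lo (fromCode d lo B c) ≡ c
toCode-fromCode d lo B zero    (h ∷ [])    _ = refl
toCode-fromCode d lo B (suc k) (j ∷ t ∷ c) l
  with fromCode d d (B + lo + j) c
     | RestrictedColumns-head (fromCode-restricted d d (B + lo + j) k c (length-drop₂ c k l))
     | toCode-fromCode d d (B + lo + j) k c (length-drop₂ c k l)
... | _ | _ , _ , refl | ih = cong₂ _∷_ (m+n∸m≡n (B + lo) j) (cong₂ _∷_ below-top ih)
  where
  below-top : B + (lo + j + t) ∸ (B + lo + j) ≡ t
  below-top = trans (cong (_∸ (B + lo + j)) (+-reassoc₄ B lo j t)) (m+n∸m≡n (B + lo + j) t)

fromCode-toCode : ∀ {d lo B cs} → RestrictedColumns d lo B cs → fromCode d lo B (toCode d lo cs) ≡ cs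
fromCode-toCode single = refl
fromCode-toCode {d} {lo} {B} (extend {h = h} {B′ = B′} gap below-top rest) with RestrictedColumns-head rest
... | h′ , cs , refl = cong₂ _∷_ (cong (B ,_) height)
  (trans (cong (λ b → fromCode d d b (toCode d d ((B′ , h′) ∷ cs))) bottom) (fromCode-toCode rest))
  where
  bottom : B + lo + (B′ ∸ (B + lo)) ≡ B′
  bottom = m+[n∸m]≡n gap
  height : lo + (B′ ∸ (B + lo)) + (B + h ∸ B′) ≡ h
  height = +-cancelˡ-≡ B _ _ (begin
    B + (lo + (B′ ∸ (B + lo)) + (B + h ∸ B′)) ≡⟨ +-reassoc₄ B lo (B′ ∸ (B + lo)) (B + h ∸ B′) ⟩
    B + lo + (B′ ∸ (B + lo)) + (B + h ∸ B′)   ≡⟨ cong (_+ (B + h ∸ B′)) bottom ⟩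
    B′ + (B + h ∸ B′)                           ≡⟨ m+[n∸m]≡n below-top ⟩
    B + h ∎)
    where open ≡-Reasoning

length-toCode : ∀ {d lo B cs} → RestrictedColumns d lo B cs → ∃[ k ] length (toCode d lo cs) ≡ suc (2 * k)
length-toCode single = 0 , refl
length-toCode (extend _ _ rest) with RestrictedColumns-head rest | length-toCode rest
... | _ , _ , refl | k , l = suc k , trans (cong (2 +_) l) (cong suc (sym (*-suc 2 k)))

gapAfter : ℕ → ℕ → ℕ → ℕ
gapAfter d lo zero    = lo
gapAfter d lo (suc x) = gapAfter d d x

gapAfter-constant : ∀ d i → gapAfter d d i ≡ d
gapAfter-constant d zero    = refl
gapAfter-constant d (suc i) = gapAfter-constant d i

LinkedColumns : ℕ → ℕ → List Column → Set
LinkedColumns d lo cs = ∀ {x B₁ h₁ B₂ h₂} → cs [ x ]= (B₁ , h₁) → cs [ suc x ]= (B₂ , h₂) →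
  B₁ + gapAfter d lo x ≤ B₂ × B₂ ≤ B₁ + h₁

restricted⇒linked : ∀ {d lo B cs} → RestrictedColumns d lo B cs → LinkedColumns d lo cs
restricted⇒linked (extend gap top rest) at-head (at-tail p) with RestrictedColumns-head rest | p
... | _ , _ , refl | at-head = gap , top
restricted⇒linked (extend _ _ rest) (at-tail p) (at-tail q) = restricted⇒linked rest p q

linked⇒restricted : ∀ {d lo} B h cs → LinkedColumns d lo ((B , h) ∷ cs) → RestrictedColumns d lo B ((B , h) ∷ cs)
linked⇒restricted B h []               _      = single
linked⇒restricted B h ((B′ , h′) ∷ cs) linked with linked at-head (at-tail at-head)
... | gap , top = extend gap top (linked⇒restricted B′ h′ cs (λ p q → linked (at-tail p) (at-tail q)))

-- Drawing columns on a grid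

inColumn : ℕ → ℕ → ℕ → Bool
inColumn (suc B) h       (suc y) = inColumn B h y
inColumn (suc B) h       zero    = false
inColumn zero    h       zero    = true
inColumn zero    zero    (suc y) = false
inColumn zero    (suc h) (suc y) = inColumn zero h y

inColumn-sound : ∀ B h y → inColumn B h y ≡ true → B ≤ y × y ≤ B + h
inColumn-sound (suc B) h       (suc y) e = let (p , q) = inColumn-sound B h y e in s≤s p , s≤s q
inColumn-sound zero    h       zero    e = z≤n , z≤n
inColumn-sound zero    (suc h) (suc y) e = z≤n , s≤s (proj₂ (inColumn-sound zero h y e))

inColumn-complete : ∀ B h y → B ≤ y → y ≤ B + h → inColumn B h y ≡ true
inColumn-complete (suc B) h       (suc y) (s≤s p) (s≤s q) = inColumn-complete B h y p q
inColumn-complete zero    h       zero    _       _       = refl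
inColumn-complete zero    (suc h) (suc y) _       (s≤s q) = inColumn-complete zero h y z≤n q

columnCell : List Column → ℕ → ℕ → Bool
columnCell []             x       y = false
columnCell ((B , h) ∷ cs) zero    y = inColumn B h y
columnCell (c ∷ cs)       (suc x) y = columnCell cs x y

columnCell-sound : ∀ cs x y → columnCell cs x y ≡ true → ∃[ B ] ∃[ h ] cs [ x ]= (B , h) × B ≤ y × y ≤ B + h
columnCell-sound ((B , h) ∷ cs) zero    y e = B , h , at-head , inColumn-sound B h y e
columnCell-sound (c ∷ cs)       (suc x) y e =
  let (B , h , p , bounds) = columnCell-sound cs x y e in B , h , at-tail p , bounds

columnCell-complete : ∀ {cs x B h y} → cs [ x ]= (B , h) → B ≤ y → y ≤ B + h → columnCell cs x y ≡ true
columnCell-complete {B = B} {h} {y} at-head     = inColumn-complete B h y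
columnCell-complete                 (at-tail p) = columnCell-complete p

tabulateBits : (k : ℕ) → (ℕ → Bool) → Vec Bool k
tabulateBits zero    f = []
tabulateBits (suc k) f = f 0 ∷ tabulateBits k (λ y → f (suc y))

tabulateGrid : (m k : ℕ) → (ℕ → ℕ → Bool) → Vec (Vec Bool k) m
tabulateGrid zero    k F = []
tabulateGrid (suc m) k F = tabulateBits k (F 0) ∷ tabulateGrid m k (λ x → F (suc x))

getB-tabulateBits : ∀ k f → (∀ y → f y ≡ true → y < k) → ∀ y → getB (tabulateBits k f) y ≡ f y
getB-tabulateBits zero    f fits y       = sym (¬-not (λ e → n≮0 (fits y e)))
getB-tabulateBits (suc k) f fits zero    = refl
getB-tabulateBits (suc k) f fits (suc y) =
  getB-tabulateBits k (λ y → f (suc y)) (λ y e → ≤-pred (fits (suc y) e)) y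

cellAt-tabulateGrid : ∀ m k F → (∀ x y → F x y ≡ true → x < m × y < k) →
  ∀ x y → cellAt (tabulateGrid m k F) x y ≡ F x y
cellAt-tabulateGrid zero    k F fits x       y = sym (¬-not (λ e → n≮0 (proj₁ (fits x y e))))
cellAt-tabulateGrid (suc m) k F fits zero    y = getB-tabulateBits k (F 0) (λ y e → proj₂ (fits 0 y e)) y
cellAt-tabulateGrid (suc m) k F fits (suc x) y =
  cellAt-tabulateGrid m k (λ x → F (suc x)) (λ x y e → let (p , q) = fits (suc x) y e in ≤-pred p , q) x y

getB-extensional : ∀ {k} (u v : Vec Bool k) → (∀ y → getB u y ≡ getB v y) → u ≡ v
getB-extensional []      []      _ = refl
getB-extensional (a ∷ u) (b ∷ v) e = cong₂ _∷_ (e 0) (getB-extensional u v (λ y → e (suc y)))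

cellAt-extensional : ∀ {m k} (G H : Vec (Vec Bool k) m) → (∀ x y → cellAt G x y ≡ cellAt H x y) → G ≡ H
cellAt-extensional []      []      _ = refl
cellAt-extensional (u ∷ G) (v ∷ H) e =
  cong₂ _∷_ (getB-extensional u v (e 0)) (cellAt-extensional G H (λ x → e (suc x)))

countTrue-false : ∀ k → countTrue (tabulateBits k (λ _ → false)) ≡ 0
countTrue-false zero    = refl
countTrue-false (suc k) = countTrue-false k

countTrue-inColumn : ∀ k B h → B + h < k → countTrue (tabulateBits k (inColumn B h)) ≡ suc h
countTrue-inColumn (suc k) (suc B) h       (s≤s fits) = countTrue-inColumn k B h fits
countTrue-inColumn (suc k) zero    zero    _          = cong suc (countTrue-false k)
countTrue-inColumn (suc k) zero    (suc h) (s≤s fits) = cong suc (countTrue-inColumn k zero h fits)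

firstTrue : ∀ {k} → Vec Bool k → ℕ
firstTrue []          = 0
firstTrue (true ∷ v)  = 0
firstTrue (false ∷ v) = suc (firstTrue v)

firstTrue-inColumn : ∀ k B h → B + h < k → firstTrue (tabulateBits k (inColumn B h)) ≡ B
firstTrue-inColumn (suc k) (suc B) h (s≤s fits) = cong suc (firstTrue-inColumn k B h fits)
firstTrue-inColumn (suc k) zero    h _          = refl

consColumn : ℕ → ℕ → List Column → List Column
consColumn zero    B cs = []
consColumn (suc h) B cs = (B , h) ∷ cs

-- Reading stops at the first empty column.
decode : ∀ {m k} → Vec (Vec Bool k) m → List Column
decode []       = []
decode (v ∷ vs) = consColumn (countTrue v) (firstTrue v) (decode vs)

FitsIn : ℕ → ℕ → List Column → Set
FitsIn m k cs = length cs ≤ m × (∀ {x B h} → cs [ x ]= (B , h) → B + h < k)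

FitsIn-tail : ∀ {m k c cs} → FitsIn (suc m) k (c ∷ cs) → FitsIn m k cs
FitsIn-tail (s≤s len , tops) = len , λ p → tops (at-tail p)

area-tabulateGrid-columnCell : ∀ m k cs → FitsIn m k cs → area (tabulateGrid m k (columnCell cs)) ≡ columnsArea cs
area-tabulateGrid-columnCell m       k []             _    = area-empty m
  where
  area-empty : ∀ m → area (tabulateGrid m k (λ _ _ → false)) ≡ 0
  area-empty zero    = refl
  area-empty (suc m) = cong₂ _+_ (countTrue-false k) (area-empty m)
area-tabulateGrid-columnCell (suc m) k ((B , h) ∷ cs) fits =
  cong₂ _+_ (countTrue-inColumn k B h (proj₂ fits at-head))
            (area-tabulateGrid-columnCell m k cs (FitsIn-tail fits))

decode-tabulateGrid-columnCell : ∀ m k cs → FitsIn m k cs → decode (tabulateGrid m k (columnCell cs)) ≡ cs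
decode-tabulateGrid-columnCell m       k []             _    = decode-empty m
  where
  decode-empty : ∀ m → decode (tabulateGrid m k (λ _ _ → false)) ≡ []
  decode-empty zero    = refl
  decode-empty (suc m) rewrite countTrue-false k = refl
decode-tabulateGrid-columnCell (suc m) k ((B , h) ∷ cs) fits
  rewrite countTrue-inColumn k B h (proj₂ fits at-head) | firstTrue-inColumn k B h (proj₂ fits at-head) =
  cong ((B , h) ∷_) (decode-tabulateGrid-columnCell m k cs (FitsIn-tail fits))

render : (n : ℕ) → List Column → Grid n
render n cs = tabulateGrid n n (columnCell cs)

cellAt-render : ∀ n cs → FitsIn n n cs → ∀ x y → cellAt (render n cs) x y ≡ columnCell cs x y
cellAt-render n cs (len , tops) = cellAt-tabulateGrid n n (columnCell cs) inside
  where
  inside : ∀ x y → columnCell cs x y ≡ true → x < n × y < n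
  inside x y e with columnCell-sound cs x y e
  ... | _ , _ , p , _ , y≤top = ≤-trans ([]=⇒<length p) len , ≤-<-trans y≤top (tops p)

render-injective : ∀ n cs cs′ → FitsIn n n cs → FitsIn n n cs′ → render n cs ≡ render n cs′ → cs ≡ cs′
render-injective n cs cs′ fits fits′ eq = begin
  cs                   ≡⟨ sym (decode-tabulateGrid-columnCell n n cs fits) ⟩
  decode (render n cs)  ≡⟨ cong decode eq ⟩
  decode (render n cs′) ≡⟨ decode-tabulateGrid-columnCell n n cs′ fits′ ⟩
  cs′                  ∎
  where open ≡-Reasoning

length≤columnsArea : ∀ cs → length cs ≤ columnsArea cs
length≤columnsArea []             = z≤n
length≤columnsArea ((B , h) ∷ cs) = s≤s (≤-trans (length≤columnsArea cs) (m≤n+m _ h))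

restricted-first-bottom : ∀ {d lo B cs B₁ h₁} → RestrictedColumns d lo B cs → cs [ 0 ]= (B₁ , h₁) → B₁ ≡ B
restricted-first-bottom single         at-head = refl
restricted-first-bottom (extend _ _ _) at-head = refl

restricted-tops : ∀ {d lo B cs x B₁ h₁} → RestrictedColumns d lo B cs → cs [ x ]= (B₁ , h₁) →
  B₁ + h₁ < B + columnsArea cs
restricted-tops {B = B} {(_ , h) ∷ cs} restricted at-head with restricted-first-bottom restricted at-head
... | refl = ≤-trans (≤-reflexive (sym (+-suc B h))) (+-monoʳ-≤ B (m≤m+n (suc h) (columnsArea cs)))
restricted-tops {B = B} {(_ , h) ∷ cs} (extend _ top rest) (at-tail p) =
  ≤-trans (restricted-tops rest p)
    (≤-trans (+-monoˡ-≤ (columnsArea cs) top)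
      (≤-trans (≤-reflexive (+-assoc B h (columnsArea cs))) (+-monoʳ-≤ B (n≤1+n _))))

restricted-fitsIn : ∀ {d lo n cs} → RestrictedColumns d lo 0 cs → columnsArea cs ≡ n → FitsIn n n cs
restricted-fitsIn {cs = cs} restricted refl = length≤columnsArea cs , restricted-tops restricted

climb : ∀ {n} {g : Grid n} {x B} t → Reach g x B → (∀ s → s ≤ t → In g x (B + s)) → Reach g x (B + t)
climb {g = g} {x} {B} zero    r _     = subst (Reach g x) (sym (+-identityʳ B)) r
climb {g = g} {x} {B} (suc t) r cells = subst (Reach g x) (sym (+-suc B t))
  (north (climb t r (λ s s≤t → cells s (m≤n⇒m≤1+n s≤t))) (subst (In g x) (+-suc B t) (cells (suc t) ≤-refl)))

module _ {d n cs} (restricted : RestrictedColumns d 0 0 cs) (columnsArea≡n : columnsArea cs ≡ n) where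
  private
    g : Grid n
    g = render n cs

    cell : ∀ x y → cellAt g x y ≡ columnCell cs x y
    cell = cellAt-render n cs (restricted-fitsIn restricted columnsArea≡n)

    toCell : ∀ {x y} → In g x y → columnCell cs x y ≡ true
    toCell {x} {y} i = trans (sym (cell x y)) i

    fromCell : ∀ {x y} → columnCell cs x y ≡ true → In g x y
    fromCell {x} {y} e = trans (cell x y) e

    reach-within : ∀ {x B h y} → cs [ x ]= (B , h) → Reach g x B → B ≤ y → y ≤ B + h → Reach g x y
    reach-within {x} {B} {h} {y} p r B≤y y≤top = subst (Reach g x) (m+[n∸m]≡n B≤y) (climb (y ∸ B) r cells)
      where
      cells : ∀ s → s ≤ y ∸ B → In g x (B + s)
      cells s s≤ = fromCell (columnCell-complete p (m≤m+n B s)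
        (≤-trans (+-monoʳ-≤ B s≤) (≤-trans (≤-reflexive (m+[n∸m]≡n B≤y)) y≤top)))

    reach-bottom : ∀ x {B h} → cs [ x ]= (B , h) → Reach g x B
    reach-bottom zero    p with restricted-first-bottom restricted p
    ... | refl = base (fromCell (columnCell-complete p z≤n z≤n))
    reach-bottom (suc x) {B₂} {h₂} p with []=-previous p
    ... | (B₁ , h₁) , q with restricted⇒linked restricted q p
    ...   | gap , top = east (reach-within q (reach-bottom x q) (≤-trans (m≤m+n B₁ _) gap) top)
                             (fromCell (columnCell-complete p ≤-refl (m≤m+n B₂ h₂)))

    bottom⇒position : ∀ {x a} → IsBottom g x a → ∃[ h ] cs [ x ]= (a , h)
    bottom⇒position {x} {a} (a∈g , a-least) with columnCell-sound cs x a (toCell a∈g)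
    ... | B , h , p , B≤a , _ with ≤-antisym B≤a (a-least B (fromCell (columnCell-complete p ≤-refl (m≤m+n B h))))
    ...   | refl = h , p

  render-isDRDCCP : IsDRDCCP d n (render n cs)
  render-isDRDCCP = (origin , λ x y i → reachable x y (toCell i)) , convex , restricted′ , area≡n
    where
    origin : In g 0 0
    origin with RestrictedColumns-head restricted
    ... | h , cs′ , eq = fromCell (columnCell-complete (subst (_[ 0 ]= (0 , h)) (sym eq) at-head) z≤n z≤n)

    reachable : ∀ x y → columnCell cs x y ≡ true → Reach g x y
    reachable x y e with columnCell-sound cs x y e
    ... | B , h , p , B≤y , y≤top = reach-within p (reach-bottom x p) B≤y y≤top

    convex : IsColumnConvex g
    convex x y₁ y y₂ y₁≤y y≤y₂ i₁ i₂ with columnCell-sound cs x y₁ (toCell i₁) | columnCell-sound cs x y₂ (toCell i₂)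
    ... | B , h , p , B≤y₁ , _ | _ , _ , p₂ , _ , y₂≤top with []=-functional p p₂
    ...   | refl = fromCell (columnCell-complete p (≤-trans B≤y₁ y₁≤y) (≤-trans y≤y₂ y₂≤top))

    restricted′ : IsRestricted d g
    restricted′ (suc x) a b _ bottom₁ bottom₂ = subst (λ g → a + g ≤ b) (gapAfter-constant d x)
      (proj₁ (restricted⇒linked restricted (proj₂ (bottom⇒position bottom₁)) (proj₂ (bottom⇒position bottom₂))))

    area≡n : area g ≡ n
    area≡n = trans (area-tabulateGrid-columnCell n n cs (restricted-fitsIn restricted columnsArea≡n)) columnsArea≡n

-- Reading columns off a polyomino

false≢true : ¬ false ≡ true
false≢true ()

ConvexBits : ∀ {k} → Vec Bool k → Set
ConvexBits v = ∀ y₁ y y₂ → y₁ ≤ y → y ≤ y₂ → getB v y₁ ≡ true → getB v y₂ ≡ true → getB v y ≡ true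

ConvexBits-tail : ∀ {k b} {v : Vec Bool k} → ConvexBits (b ∷ v) → ConvexBits v
ConvexBits-tail convex y₁ y y₂ y₁≤y y≤y₂ = convex (suc y₁) (suc y) (suc y₂) (s≤s y₁≤y) (s≤s y≤y₂)

getB-countTrue-zero : ∀ {k} (v : Vec Bool k) → countTrue v ≡ 0 → ∀ y → getB v y ≡ false
getB-countTrue-zero []          _ y       = refl
getB-countTrue-zero (false ∷ v) e zero    = refl
getB-countTrue-zero (false ∷ v) e (suc y) = getB-countTrue-zero v e y

countTrue-getB-false : ∀ {k} (v : Vec Bool k) → (∀ y → getB v y ≡ false) → countTrue v ≡ 0
countTrue-getB-false []          _     = refl
countTrue-getB-false (true ∷ v)  blank = ⊥-elim (false≢true (sym (blank 0)))
countTrue-getB-false (false ∷ v) blank = countTrue-getB-false v (λ y → blank (suc y))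

getB-firstTrue : ∀ {k} (v : Vec Bool k) h → countTrue v ≡ suc h → getB v (firstTrue v) ≡ true
getB-firstTrue (true ∷ v)  h _ = refl
getB-firstTrue (false ∷ v) h e = getB-firstTrue v h e

firstTrue-after-true : ∀ {k} (v : Vec Bool k) h → ConvexBits (true ∷ v) → countTrue v ≡ suc h → firstTrue v ≡ 0
firstTrue-after-true (true ∷ v)  h _      _ = refl
firstTrue-after-true (false ∷ v) h convex e =
  ⊥-elim (false≢true (convex 0 1 (2 + firstTrue v) z≤n (s≤s z≤n) refl (getB-firstTrue v h e)))

convex-interval : ∀ {k} (v : Vec Bool k) h → ConvexBits v → countTrue v ≡ suc h →
  ∀ y → getB v y ≡ inColumn (firstTrue v) h y
convex-interval (false ∷ v) h       convex e zero    = refl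
convex-interval (false ∷ v) h       convex e (suc y) = convex-interval v h (ConvexBits-tail convex) e y
convex-interval (true ∷ v)  h       convex e zero    = refl
convex-interval (true ∷ v)  zero    convex e (suc y) = getB-countTrue-zero v (suc-injective e) y
convex-interval (true ∷ v)  (suc h) convex e (suc y) =
  trans (convex-interval v h (ConvexBits-tail convex) (suc-injective e) y)
        (cong (λ B → inColumn B h y) (firstTrue-after-true v h convex (suc-injective e)))

ConvexColumns : ∀ {m k} → Vec (Vec Bool k) m → Set
ConvexColumns G = ∀ x y₁ y y₂ → y₁ ≤ y → y ≤ y₂ → cellAt G x y₁ ≡ true → cellAt G x y₂ ≡ true → cellAt G x y ≡ true

NonemptyLeftNeighbours : ∀ {m k} → Vec (Vec Bool k) m → Set
NonemptyLeftNeighbours G = ∀ x y → cellAt G (suc x) y ≡ true → ∃[ y′ ] cellAt G x y′ ≡ true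

blank-after-empty : ∀ {m k} (G : Vec (Vec Bool k) m) → NonemptyLeftNeighbours G →
  (∀ y → cellAt G 0 y ≡ false) → ∀ x y → cellAt G x y ≡ false
blank-after-empty G neighbours empty zero    y = empty y
blank-after-empty G neighbours empty (suc x) y = ¬-not λ e →
  let (y′ , e′) = neighbours x y e in false≢true (trans (sym (blank-after-empty G neighbours empty x y′)) e′)

area-blank : ∀ {m k} (G : Vec (Vec Bool k) m) → (∀ x y → cellAt G x y ≡ false) → area G ≡ 0
area-blank []      _     = refl
area-blank (v ∷ G) blank = cong₂ _+_ (countTrue-getB-false v (blank 0)) (area-blank G (λ x → blank (suc x)))

cellAt-decode : ∀ {m k} (G : Vec (Vec Bool k) m) → ConvexColumns G → NonemptyLeftNeighbours G →
  ∀ x y → cellAt G x y ≡ columnCell (decode G) x y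
cellAt-decode []      _      _          x y = refl
cellAt-decode (v ∷ G) convex neighbours x y with countTrue v in e
... | zero  = blank-after-empty (v ∷ G) neighbours (getB-countTrue-zero v e) x y
... | suc h with x
...   | zero  = convex-interval v h (convex 0) e y
...   | suc x = cellAt-decode G (λ x → convex (suc x)) (λ x → neighbours (suc x)) x y

columnsArea-decode : ∀ {m k} (G : Vec (Vec Bool k) m) → NonemptyLeftNeighbours G → columnsArea (decode G) ≡ area G
columnsArea-decode []      _          = refl
columnsArea-decode (v ∷ G) neighbours with countTrue v in e
... | zero  = sym (area-blank G (λ x → blank-after-empty (v ∷ G) neighbours (getB-countTrue-zero v e) (suc x)))
... | suc h = cong (suc h +_) (columnsArea-decode G (λ x → neighbours (suc x)))

Reach⇒In : ∀ {n} {g : Grid n} {x y} → Reach g x y → In g x y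
Reach⇒In (base i)    = i
Reach⇒In (north _ i) = i
Reach⇒In (east _ i)  = i

entered-from-left : ∀ {n} {g : Grid n} {x y} → Reach g (suc x) y → ∃[ y′ ] y′ ≤ y × In g x y′ × In g (suc x) y′
entered-from-left (north r _) with entered-from-left r
... | y′ , y′≤y , left , right = y′ , m≤n⇒m≤1+n y′≤y , left , right
entered-from-left (east r i) = _ , ≤-refl , Reach⇒In r , i

module _ {d n} {g : Grid n} (polyomino : IsDRDCCP d n g) where
  private
    directed : IsDirected g
    directed = proj₁ polyomino

    convex : IsColumnConvex g
    convex = proj₁ (proj₂ polyomino)

    restricted : IsRestricted d g
    restricted = proj₁ (proj₂ (proj₂ polyomino))

    area≡n : area g ≡ n
    area≡n = proj₂ (proj₂ (proj₂ polyomino))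

    entry : ∀ {x y} → In g (suc x) y → ∃[ y′ ] y′ ≤ y × In g x y′ × In g (suc x) y′
    entry {x} {y} i = entered-from-left (proj₂ directed (suc x) y i)

    neighbours : NonemptyLeftNeighbours g
    neighbours x y i = let (y′ , _ , left , _) = entry i in y′ , left

    cs : List Column
    cs = decode g

    cell : ∀ x y → cellAt g x y ≡ columnCell cs x y
    cell = cellAt-decode g convex neighbours

    toCell : ∀ {x y} → In g x y → columnCell cs x y ≡ true
    toCell {x} {y} i = trans (sym (cell x y)) i

    fromCell : ∀ {x y} → columnCell cs x y ≡ true → In g x y
    fromCell {x} {y} e = trans (cell x y) e

    position⇒bottom : ∀ {x B h} → cs [ x ]= (B , h) → IsBottom g x B
    position⇒bottom {B = B} {h} p = fromCell (columnCell-complete p ≤-refl (m≤m+n B h)) , λ y i →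
      let (_ , _ , p′ , B′≤y , _) = columnCell-sound cs _ y (toCell i) in
      subst (_≤ y) (cong proj₁ ([]=-functional p′ p)) B′≤y

    linked : LinkedColumns d 0 cs
    linked {x} {B₁} {h₁} {B₂} {h₂} p q with position⇒bottom q
    ... | B₂∈g , B₂-least with entry B₂∈g
    ...   | y′ , y′≤B₂ , left , right with ≤-antisym y′≤B₂ (B₂-least y′ right)
    ...     | refl with columnCell-sound cs x y′ (toCell left)
    ...       | _ , _ , p′ , B₁≤B₂ , B₂≤top with []=-functional p′ p
    ...         | refl = gap x p q , B₂≤top
      where
      gap : ∀ x → cs [ x ]= (B₁ , h₁) → cs [ suc x ]= (B₂ , h₂) → B₁ + gapAfter d 0 x ≤ B₂
      gap zero    _ _ = subst (_≤ B₂) (sym (+-identityʳ B₁)) B₁≤B₂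
      gap (suc x) p q = subst (λ g → B₁ + g ≤ B₂) (sym (gapAfter-constant d x))
                              (restricted (suc x) B₁ B₂ (s≤s z≤n) (position⇒bottom p) (position⇒bottom q))

  decode-restricted : RestrictedColumns d 0 0 (decode g)
  decode-restricted with columnCell-sound cs 0 0 (toCell (proj₁ directed))
  ... | B , h , p , B≤0 , _ with n≤0⇒n≡0 B≤0 | []=-head p
  ...   | refl | cs′ , eq =
    subst (RestrictedColumns d 0 0) (sym eq) (linked⇒restricted 0 h cs′ (subst (LinkedColumns d 0) eq linked))

  columnsArea-decode≡n : columnsArea (decode g) ≡ n
  columnsArea-decode≡n = trans (columnsArea-decode g neighbours) area≡n

  render-decode : render n (decode g) ≡ g
  render-decode = cellAt-extensional (render n cs) g λ x y →
    trans (cellAt-render n cs (restricted-fitsIn decode-restricted columnsArea-decode≡n) x y) (sym (cell x y))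

-- Counting codes

record IsCode (d n k : ℕ) (c : List ℕ) : Set where
  constructor code
  field
    code-length : length c ≡ suc (2 * k)
    code-area   : sum c + minArea d 0 k ≡ n

codesOfSize : ℕ → ℕ → ℕ → List (List ℕ)
codesOfSize d n k with minArea d 0 k ≤? n
... | yes _ = compositions (2 * k) (n ∸ minArea d 0 k)
... | no  _ = []

codesOfSize-sound : ∀ d n k {c} → c ∈ codesOfSize d n k → IsCode d n k c
codesOfSize-sound d n k c∈ with minArea d 0 k ≤? n
... | yes M≤n = let open IsWeakComposition (All.lookup (compositions-sound (2 * k) (n ∸ minArea d 0 k)) c∈) in
  code parts (trans (cong (_+ minArea d 0 k) total) (m∸n+n≡m M≤n))

codesOfSize-complete : ∀ d n k {c} → IsCode d n k c → c ∈ codesOfSize d n k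
codesOfSize-complete d n k {c} (code l a) with minArea d 0 k ≤? n
... | yes _  = compositions-complete (2 * k) (n ∸ minArea d 0 k) c
                 (weakComposition l (trans (sym (m+n∸n≡m (sum c) (minArea d 0 k))) (cong (_∸ minArea d 0 k) a)))
... | no M≰n = ⊥-elim (M≰n (subst (minArea d 0 k ≤_) a (m≤n+m (minArea d 0 k) (sum c))))

codesOfSize-unique : ∀ d n k → Unique (codesOfSize d n k)
codesOfSize-unique d n k with minArea d 0 k ≤? n
... | yes _ = compositions-unique (2 * k) (n ∸ minArea d 0 k)
... | no  _ = AllPairs.[]

codesUpTo : ℕ → ℕ → ℕ → List (List ℕ)
codesUpTo d n K = concatMap (codesOfSize d n) (upTo K)

codesUpTo-unique : ∀ d n K → Unique (codesUpTo d n K)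
codesUpTo-unique d n K = Unique.concat⁺
  (All.map⁺ (All.universal (codesOfSize-unique d n) (upTo K)))
  (AllPairs.map⁺ (AllPairs.map disjoint (Unique.upTo⁺ K)))
  where
  disjoint : ∀ {k k′} → ¬ k ≡ k′ → ∀ {c} → ¬ (c ∈ codesOfSize d n k × c ∈ codesOfSize d n k′)
  disjoint {k} {k′} k≢k′ {c} (c∈ , c∈′) = k≢k′ (*-cancelˡ-≡ k k′ 2 (suc-injective (trans (sym l) l′)))
    where
    l : length c ≡ suc (2 * k)
    l = IsCode.code-length (codesOfSize-sound d n k c∈)
    l′ : length c ≡ suc (2 * k′)
    l′ = IsCode.code-length (codesOfSize-sound d n k′ c∈′)

codesUpTo-sound : ∀ d n K {c} → c ∈ codesUpTo d n K → ∃[ k ] IsCode d n k c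
codesUpTo-sound d n K c∈ = let (k , c∈k) = satisfied (∈-concatMap⁻ (codesOfSize d n) {xs = upTo K} c∈) in
  k , codesOfSize-sound d n k c∈k

codesUpTo-complete : ∀ d n K {k c} → IsCode d n k c → k < K → c ∈ codesUpTo d n K
codesUpTo-complete d n K {k} isCode k<K =
  ∈-concatMap⁺ (codesOfSize d n) (lose (∈-upTo⁺ k<K) (codesOfSize-complete d n k isCode))

minArea-closed : ∀ d m → minArea d d m ≡ suc m + m * d
minArea-closed d zero    = refl
minArea-closed d (suc m) = trans (cong (λ a → suc (d + a)) (minArea-closed d m)) (expand d m)
  where
  expand : ∀ d m → suc (d + (suc m + m * d)) ≡ suc (suc m) + suc m * d
  expand = solve-∀

-- minArea (suc e) 0 k = 2k + e (k − 1) for k = m + 1, stated without its leading suc.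
minArea-identity : ∀ e m → minArea (suc e) (suc e) m + e ≡ e * suc m + suc (2 * m)
minArea-identity e m = trans (cong (_+ e) (minArea-closed (suc e) m)) (rearrange e m)
  where
  rearrange : ∀ e m → suc m + m * suc e + e ≡ e * suc m + suc (2 * m)
  rearrange = solve-∀

length-codesOfSize : ∀ e n k → 1 ≤ n → length (codesOfSize (suc e) n k) ≡ (n + e ∸ e * k) C (2 * k)
length-codesOfSize e n k 1≤n with minArea (suc e) 0 k ≤? n
length-codesOfSize e n zero    _   | yes _    = refl
length-codesOfSize e n (suc m) _   | yes M≤n  =
  trans (length-compositions (2 * suc m) (n ∸ M)) (cong (_C (2 * suc m)) (sym free+2k))
  where
  M : ℕ
  M = minArea (suc e) 0 (suc m)
  free+2k : n + e ∸ e * suc m ≡ n ∸ M + 2 * suc m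
  free+2k = begin
    n + e ∸ e * suc m
      ≡⟨ cong (λ a → a + e ∸ e * suc m) (sym (m+[n∸m]≡n M≤n)) ⟩
    M + (n ∸ M) + e ∸ e * suc m
      ≡⟨ cong (_∸ e * suc m) (regroup (minArea (suc e) (suc e) m) (n ∸ M) e) ⟩
    suc (minArea (suc e) (suc e) m + e + (n ∸ M)) ∸ e * suc m
      ≡⟨ cong (λ a → suc (a + (n ∸ M)) ∸ e * suc m) (minArea-identity e m) ⟩
    suc (e * suc m + suc (2 * m) + (n ∸ M)) ∸ e * suc m
      ≡⟨ cong (_∸ e * suc m) (regroup′ (e * suc m) m (n ∸ M)) ⟩
    e * suc m + (n ∸ M + 2 * suc m) ∸ e * suc m
      ≡⟨ m+n∸m≡n (e * suc m) (n ∸ M + 2 * suc m) ⟩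
    n ∸ M + 2 * suc m ∎
    where
    open ≡-Reasoning
    regroup : ∀ a r e → suc a + r + e ≡ suc (a + e + r)
    regroup = solve-∀
    regroup′ : ∀ a m r → suc (a + suc (2 * m) + r) ≡ a + (r + 2 * suc m)
    regroup′ = solve-∀
length-codesOfSize e n zero    1≤n | no M≰n = ⊥-elim (M≰n 1≤n)
length-codesOfSize e n (suc m) _   | no M≰n = sym (k>n⇒nCk≡0 (begin-strict
  n + e ∸ e * suc m                                  ≤⟨ ∸-monoˡ-≤ (e * suc m) (+-monoˡ-≤ e n≤M′) ⟩
  minArea (suc e) (suc e) m + e ∸ e * suc m          ≡⟨ cong (_∸ e * suc m) (minArea-identity e m) ⟩
  e * suc m + suc (2 * m) ∸ e * suc m                ≡⟨ m+n∸m≡n (e * suc m) (suc (2 * m)) ⟩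
  suc (2 * m)                                        <⟨ n<1+n (suc (2 * m)) ⟩
  suc (suc (2 * m))                                  ≡⟨ sym (*-suc 2 m) ⟩
  2 * suc m                                          ∎))
  where
  open ≤-Reasoning
  n≤M′ : n ≤ minArea (suc e) (suc e) m
  n≤M′ = ≤-pred (≰⇒> M≰n)

size-bound : ∀ e n k → minArea (suc e) 0 k ≤ n → k ≤ (n + suc e ∸ 2) / suc e
size-bound e n zero    _   = z≤n
size-bound e n (suc m) M≤n = subst (_≤ (n + suc e ∸ 2) / suc e) (m*n/n≡m (suc m) (suc e)) (/-monoˡ-≤ (suc e) (begin
  suc m * suc e                              ≤⟨ m≤m+n (suc m * suc e) m ⟩
  suc m * suc e + m                          ≡⟨ rearrange e m ⟩
  e * suc m + suc (2 * m)                    ≡⟨ sym (minArea-identity e m) ⟩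
  minArea (suc e) (suc e) m + e              ≡⟨ cong (_∸ 1) (sym (+-suc (minArea (suc e) (suc e) m) e)) ⟩
  minArea (suc e) 0 (suc m) + suc e ∸ 2      ≤⟨ ∸-monoˡ-≤ 2 (+-monoˡ-≤ (suc e) M≤n) ⟩
  n + suc e ∸ 2                              ∎))
  where
  open ≤-Reasoning
  rearrange : ∀ e m → suc m * suc e + m ≡ e * suc m + suc (2 * m)
  rearrange = solve-∀

IsCode⇒minArea≤ : ∀ {d n k c} → IsCode d n k c → minArea d 0 k ≤ n
IsCode⇒minArea≤ {d} {k = k} {c} (code _ a) = subst (minArea d 0 k ≤_) a (m≤n+m (minArea d 0 k) (sum c))

-- Polyominoes from codes

polyomino : ℕ → (n : ℕ) → List ℕ → Grid n
polyomino d n c = render n (fromCode d 0 0 c)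

IsCode⇒restricted : ∀ {d n k c} → IsCode d n k c → RestrictedColumns d 0 0 (fromCode d 0 0 c)
IsCode⇒restricted {d} {k = k} {c} (code l _) = fromCode-restricted d 0 0 k c l

IsCode⇒columnsArea : ∀ {d n k c} → IsCode d n k c → columnsArea (fromCode d 0 0 c) ≡ n
IsCode⇒columnsArea {d} {k = k} {c} (code l a) = trans (columnsArea-fromCode d 0 0 k c l) a

polyomino-isDRDCCP : ∀ {d n k c} → IsCode d n k c → IsDRDCCP d n (polyomino d n c)
polyomino-isDRDCCP isCode = render-isDRDCCP (IsCode⇒restricted isCode) (IsCode⇒columnsArea isCode)

polyomino-injective : ∀ {d n k k′ c c′} → IsCode d n k c → IsCode d n k′ c′ → polyomino d n c ≡ polyomino d n c′ → c ≡ c′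
polyomino-injective {d} {n} {k} {k′} {c} {c′} isCode isCode′ eq = begin
  c                              ≡⟨ sym (toCode-fromCode d 0 0 k c (IsCode.code-length isCode)) ⟩
  toCode d 0 (fromCode d 0 0 c)  ≡⟨ cong (toCode d 0) (render-injective n _ _ (fits isCode) (fits isCode′) eq) ⟩
  toCode d 0 (fromCode d 0 0 c′) ≡⟨ toCode-fromCode d 0 0 k′ c′ (IsCode.code-length isCode′) ⟩
  c′                             ∎
  where
  open ≡-Reasoning
  fits : ∀ {k c} → IsCode d n k c → FitsIn n n (fromCode d 0 0 c)
  fits isCode = restricted-fitsIn (IsCode⇒restricted isCode) (IsCode⇒columnsArea isCode)

isDRDCCP⇒polyomino : ∀ {d n} {g : Grid n} → IsDRDCCP d n g → ∃[ k ] ∃[ c ] IsCode d n k c × g ≡ polyomino d n c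
isDRDCCP⇒polyomino {d} {n} {g} P with length-toCode (decode-restricted P)
... | k , l = k , c , code l area≡n , g≡polyomino
  where
  c : List ℕ
  c = toCode d 0 (decode g)
  g≡polyomino : g ≡ polyomino d n c
  g≡polyomino = trans (sym (render-decode P)) (cong (render n) (sym (fromCode-toCode (decode-restricted P))))
  area≡n : sum c + minArea d 0 k ≡ n
  area≡n = begin
    sum c + minArea d 0 k           ≡⟨ sym (columnsArea-fromCode d 0 0 k c l) ⟩
    columnsArea (fromCode d 0 0 c)  ≡⟨ cong columnsArea (fromCode-toCode (decode-restricted P)) ⟩
    columnsArea (decode g)          ≡⟨ columnsArea-decode≡n P ⟩
    n                               ∎
    where open ≡-Reasoning

mainTheorem1 : (d n : ℕ) → .{{_ : NonZero d}} → 1 ≤ n →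
    Σ (List (Grid n)) (λ L →
      Unique L × All (IsDRDCCP d n) L × (∀ g → IsDRDCCP d n g → g ∈ L) × length L ≡ formula d n)
mainTheorem1 zero    n {{nonZero}} _ = ⊥-elim-irr (NonZero.nonZero nonZero)
mainTheorem1 (suc e) n 1≤n = map (polyomino d n) codes , unique , sound , complete , count
  where
  d : ℕ
  d = suc e
  K : ℕ
  K = suc ((n + d ∸ 2) / d)
  codes : List (List ℕ)
  codes = codesUpTo d n K
  unique : Unique (map (polyomino d n) codes)
  unique = map⁺-injectiveOn (polyomino d n) (codesUpTo-unique d n K) λ c∈ c′∈ →
    polyomino-injective (proj₂ (codesUpTo-sound d n K c∈)) (proj₂ (codesUpTo-sound d n K c′∈))
  sound : All (IsDRDCCP d n) (map (polyomino d n) codes)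
  sound = All.map⁺ (All.tabulate λ c∈ → polyomino-isDRDCCP (proj₂ (codesUpTo-sound d n K c∈)))
  complete : ∀ g → IsDRDCCP d n g → g ∈ map (polyomino d n) codes
  complete g P with isDRDCCP⇒polyomino P
  ... | k , c , isCode , refl =
    ∈-map⁺ (polyomino d n) (codesUpTo-complete d n K isCode (s≤s (size-bound e n k (IsCode⇒minArea≤ isCode))))
  count : length (map (polyomino d n) codes) ≡ formula d n
  count = trans (length-map (polyomino d n) codes) (trans (length-concatMap (codesOfSize d n) (upTo K))
                (cong sum (map-cong (λ k → length-codesOfSize e n k 1≤n) (upTo K))))
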